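{- Let $\mathcal{R}$ be a TRS and $\Pi$ a set of forbidden patterns. If $C[s]_p \overset{\ge p}{\rightarrow}_{\Pi} C[t]_p$, then $s\rightarrow_{\Pi}t$.
   Context: Positions are finite sequences of positive integers; $q\ge p$ means $p$ is a prefix of $q$ ($q$ at or below $p$). A context $C[\Box]_p$ is a term with a single hole at position $p$; $C[u]_p$ fills it with $u$. Forbidden patterns: triples $\langle t,p,\lambda\rangle$, $t$ a term, $p\in Pos(t)$, $\lambda\in\{h,b,a\}$. For a term $s$, $P_{t,p}(s)=\{o.p\mid s|_o=t\sigma$ for some substitution $\sigma$ and position $o\}$; for $\pi=\langle t,p,\lambda\rangle$, $P_\pi(s)=\{o\in Pos(s)\mid\exists q\in P_{t,p}(s):o<q\}$ if $\lambda=a$, $\{o\in Pos(s)\mid\exists q\in P_{t,p}(s):o>q\}$ if $\lambda=b$, $P_{t,p}(s)$ if $\lambda=h$ (here $o<q$ means $o$ is a proper prefix of $q$). Forbidden positions of $s$ w.r.t. $\Pi$: $\bigcup_{\pi\in\Pi}P_\pi(s)$; the others are allowed. $s\rightarrow_\Pi t$ denotes an $\mathcal{R}$-rewrite step contracting a redex at a position allowed in $s$ w.r.t. $\Pi$; $\overset{\ge p}{\rightarrow}_\Pi$ denotes such a step at a position at or below $p$. -}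

module Defs where

open import Data.Nat using (ℕ; zero; suc)
open import Data.Fin using (Fin; toℕ)
open import Data.Vec using (Vec; []; _∷_; lookup; _[_]≔_)
open import Data.List using (List; []; _∷_; _++_)
open import Data.Product using (Σ; ∃; ∃-syntax; _×_; _,_)
open import Relation.Binary.PropositionalEquality using (_≡_)
open import Relation.Nullary using (¬_)

module Rewriting (F : Set) (ar : F → ℕ) (V : Set) where

  data Term : Set where
    var : V → Term
    fun : (f : F) → Vec Term (ar f) → Term

  Subst : Set
  Subst = V → Term

  mutual
    _⟨_⟩ : Term → Subst → Term
    var x ⟨ σ ⟩ = σ x
    fun f ts ⟨ σ ⟩ = fun f (ts ⟨ σ ⟩*)

    _⟨_⟩* : ∀ {n} → Vec Term n → Subst → Vec Term n
    [] ⟨ σ ⟩* = []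
    (t ∷ ts) ⟨ σ ⟩* = (t ⟨ σ ⟩) ∷ (ts ⟨ σ ⟩*)

  -- Positions: finite sequences of positive integers; the integer i
  -- (i ≥ 1) selects the i-th argument (1-based).
  Pos : Set
  Pos = List ℕ

  data Subterm : Term → Pos → Term → Set where
    here  : ∀ {s} → Subterm s [] s
    there : ∀ {f ts p u} (k : Fin (ar f)) →
            Subterm (lookup ts k) p u →
            Subterm (fun f ts) (suc (toℕ k) ∷ p) u

  _∈Pos_ : Pos → Term → Set
  p ∈Pos s = ∃[ u ] Subterm s p u

  -- Replace C p u v  :  p ∈ Pos(C) and v = C[u]_p
  -- (a context C[□]_p is represented by a term C with a position p;
  --  the subterm of C at p plays no role)
  data Replace : Term → Pos → Term → Term → Set where
    here  : ∀ {s u} → Replace s [] u u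
    there : ∀ {f ts p u v} (k : Fin (ar f)) →
            Replace (lookup ts k) p u v →
            Replace (fun f ts) (suc (toℕ k) ∷ p) u (fun f (ts [ k ]≔ v))

  _≤ₚ_ : Pos → Pos → Set
  p ≤ₚ q = ∃[ r ] p ++ r ≡ q

  _<ₚ_ : Pos → Pos → Set
  p <ₚ q = ∃[ r ] (¬ r ≡ []) × (p ++ r ≡ q)

  data _∈Var_ (x : V) : Term → Set where
    var≡ : x ∈Var var x
    arg  : ∀ {f ts} (k : Fin (ar f)) → x ∈Var lookup ts k → x ∈Var fun f ts

  record TRS : Set₁ where
    field
      rules     : Term × Term → Set
      lhs-nonvar : ∀ {l r} → rules (l , r) → ∀ x → ¬ l ≡ var x
      var-cond  : ∀ {l r} → rules (l , r) → ∀ {x} → x ∈Var r → x ∈Var l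
  open TRS public

  data Kind : Set where
    h b a : Kind

  record ForbiddenPattern : Set where
    constructor ⟨_,_,_,_⟩
    field
      pterm : Term
      ppos  : Pos
      ppos∈ : ppos ∈Pos pterm
      kind  : Kind
  open ForbiddenPattern public

  P[_,_] : Term → Pos → Term → Pos → Set
  P[ t , p ] s q = ∃[ o ] ∃[ σ ] Subterm s o (t ⟨ σ ⟩) × (q ≡ o ++ p)

  Pπ : ForbiddenPattern → Term → Pos → Set
  Pπ ⟨ t , p , _ , a ⟩ s o = o ∈Pos s × ∃[ q ] P[ t , p ] s q × (o <ₚ q)
  Pπ ⟨ t , p , _ , b ⟩ s o = o ∈Pos s × ∃[ q ] P[ t , p ] s q × (q <ₚ o)
  Pπ ⟨ t , p , _ , h ⟩ s o = P[ t , p ] s o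

  Forbidden : (ForbiddenPattern → Set) → Term → Pos → Set
  Forbidden Π s o = ∃[ π ] Π π × Pπ π s o

  Allowed : (ForbiddenPattern → Set) → Term → Pos → Set
  Allowed Π s o = o ∈Pos s × ¬ Forbidden Π s o

  StepAt : TRS → (ForbiddenPattern → Set) → Pos → Term → Term → Set
  StepAt R Π q s t =
    ∃[ l ] ∃[ r ] rules R (l , r) × ∃[ σ ]
      (Subterm s q (l ⟨ σ ⟩) × Replace s q (r ⟨ σ ⟩) t × Allowed Π s q)

  Step : TRS → (ForbiddenPattern → Set) → Term → Term → Set
  Step R Π s t = ∃[ q ] StepAt R Π q s t

  StepBelow : TRS → (ForbiddenPattern → Set) → Pos → Term → Term → Set
  StepBelow R Π p s t = ∃[ q ] (p ≤ₚ q) × StepAt R Π q s t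

module Submission where

-- Write C[s]_p for the term obtained from C by
-- putting s at position p.  A step C[s]_p →_Π D at a position p.q at or
-- below the hole only looks inside s, so it is a step s →_Π s' at q with
-- D = C[s']_p; if moreover D = C[t]_p then s' = t because plugging a context
-- is injective in the plugged term.  The step at q in s is allowed because
-- forbiddenness transfers outward: every pattern match of s at o is a match
-- of C[s]_p at p.o, and prepending p preserves the (proper) prefix order.

open import Defs
open import Data.Nat using (ℕ; suc)
open import Data.Nat.Properties using (suc-injective)
open import Data.Fin using (Fin; toℕ)
open import Data.Fin.Properties using (toℕ-injective)
open import Data.Vec using (Vec; lookup; _[_]≔_)
open import Data.Vec.Properties using (lookup∘update; []≔-idempotent)
open import Data.List using (_∷_; _++_)
open import Data.List.Properties using (++-assoc; ∷-injective)
open import Data.Product using (∃-syntax; _×_; _,_)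
open import Relation.Binary.PropositionalEquality
  using (_≡_; refl; sym; trans; cong; subst; module ≡-Reasoning)

module Plugging (F : Set) (ar : F → ℕ) (V : Set) where
  open Rewriting F ar V

  argPos-injective : ∀ {n} {k k' : Fin n} {p p' : Pos} →
    suc (toℕ k') ∷ p' ≡ suc (toℕ k) ∷ p → k' ≡ k × p' ≡ p
  argPos-injective e with ∷-injective e
  ... | ek , ep = toℕ-injective (suc-injective ek) , ep

  fun-injective : ∀ {f} {xs ys : Vec Term (ar f)} → fun f xs ≡ fun f ys → xs ≡ ys
  fun-injective refl = refl

  Subterm-updated : ∀ {f} (ts : Vec Term (ar f)) k v {q u} →
    Subterm (lookup (ts [ k ]≔ v) k) q u → Subterm v q u
  Subterm-updated ts k v = subst (λ z → Subterm z _ _) (lookup∘update k ts v)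

  Subterm-below-hole : ∀ {C p s Cs} → Replace C p s Cs → ∀ {r q u} →
    Subterm Cs r u → r ≡ p ++ q → Subterm s q u
  Subterm-below-hole here sub refl = sub
  Subterm-below-hole (there k plug) here ()
  Subterm-below-hole (there {ts = ts} {v = v} k plug) (there k' sub) e
    with argPos-injective e
  ... | refl , e' = Subterm-below-hole plug (Subterm-updated ts k v sub) e'

  Subterm-plugged : ∀ {C p s Cs} → Replace C p s Cs → ∀ {q u} →
    Subterm s q u → Subterm Cs (p ++ q) u
  Subterm-plugged here sub = sub
  Subterm-plugged (there {ts = ts} {v = v} k plug) sub =
    there k (subst (λ z → Subterm z _ _) (sym (lookup∘update k ts v))
                   (Subterm-plugged plug sub))

  Replace-below-hole : ∀ {C p s Cs} → Replace C p s Cs → ∀ {r q w D} →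
    Replace Cs r w D → r ≡ p ++ q →
    ∃[ s' ] Replace s q w s' × Replace C p s' D
  Replace-below-hole here rep refl = _ , rep , here
  Replace-below-hole (there k plug) here ()
  Replace-below-hole (there {f = f} {ts = ts} {v = v} k plug) (there k' rep) e
    with argPos-injective e
  ... | refl , e'
    with Replace-below-hole plug (subst (λ z → Replace z _ _ _) (lookup∘update k ts v) rep) e'
  ... | s' , inner , outer =
    s' , inner ,
    subst (λ z → Replace (fun f ts) _ s' (fun f z)) (sym ([]≔-idempotent ts k)) (there k outer)

  -- Plugging a fixed context is injective: C[x]_p = C[y]_p implies x = y.
  -- The auxiliary go allows the two holes to be given as equal positions.
  plug-injective : ∀ {C p x y D D'} → Replace C p x D → Replace C p y D' →
    D ≡ D' → x ≡ y
  plug-injective rx ry = go rx ry refl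
    where
    go : ∀ {C p p' x y D D'} → Replace C p x D → Replace C p' y D' →
      p ≡ p' → D ≡ D' → x ≡ y
    go here here _ eD = eD
    go here (there k r) () _
    go (there k r) here () _
    go (there {ts = ts} {v = v} k r) (there {v = v'} k' r') ep eD
      with argPos-injective (sym ep)
    ... | refl , ep' = go r r' (sym ep') argument-eq
      where
      open ≡-Reasoning
      argument-eq : v ≡ v'
      argument-eq = begin
        v                       ≡⟨ sym (lookup∘update k ts v) ⟩
        lookup (ts [ k ]≔ v)  k ≡⟨ cong (λ z → lookup z k) (fun-injective eD) ⟩
        lookup (ts [ k ]≔ v') k ≡⟨ lookup∘update k ts v' ⟩
        v'                      ∎

  <ₚ-prepend : ∀ p {o q} → o <ₚ q → (p ++ o) <ₚ (p ++ q)
  <ₚ-prepend p {o} (r , r≢[] , e) = r , r≢[] , trans (++-assoc p o r) (cong (p ++_) e)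

  P-plugged : ∀ {C p s Cs} → Replace C p s Cs → ∀ {t pp q} →
    P[ t , pp ] s q → P[ t , pp ] Cs (p ++ q)
  P-plugged {p = p} plug {pp = pp} (o , σ , sub , refl) =
    p ++ o , σ , Subterm-plugged plug sub , sym (++-assoc p o pp)

  Forbidden-plugged : ∀ {C p s Cs} → Replace C p s Cs → ∀ Π {q} →
    Forbidden Π s q → Forbidden Π Cs (p ++ q)
  Forbidden-plugged plug Π (⟨ t , pp , w , h ⟩ , π∈Π , occ) =
    _ , π∈Π , P-plugged plug {t} {pp} occ
  Forbidden-plugged {p = p} plug Π (⟨ t , pp , w , a ⟩ , π∈Π , ((u , sub) , q' , occ , q<q')) =
    _ , π∈Π , ((u , Subterm-plugged plug sub) , p ++ q' , P-plugged plug {t} {pp} occ , <ₚ-prepend p q<q')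
  Forbidden-plugged {p = p} plug Π (⟨ t , pp , w , b ⟩ , π∈Π , ((u , sub) , q' , occ , q'<q)) =
    _ , π∈Π , ((u , Subterm-plugged plug sub) , p ++ q' , P-plugged plug {t} {pp} occ , <ₚ-prepend p q'<q)

  Allowed-below-hole : ∀ {C p s Cs} → Replace C p s Cs → ∀ Π {q u} →
    Subterm s q u → Allowed Π Cs (p ++ q) → Allowed Π s q
  Allowed-below-hole plug Π sub (_ , notForbidden) =
    (_ , sub) , λ forb → notForbidden (Forbidden-plugged plug Π forb)

  StepAt-below-hole : ∀ R Π {C p s Cs q D} → Replace C p s Cs →
    StepAt R Π (p ++ q) Cs D → ∃[ s' ] StepAt R Π q s s' × Replace C p s' D
  StepAt-below-hole R Π {s = s} {q = q} plug (l , r , l→r , σ , redex , contract , allowed)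
    with Replace-below-hole plug contract refl
  ... | s' , inner , outer =
    s' , (l , r , l→r , σ , redex′ , inner , Allowed-below-hole plug Π redex′ allowed) , outer
    where
    redex′ : Subterm s q (l ⟨ σ ⟩)
    redex′ = Subterm-below-hole plug redex refl

lemma3 : (F : Set) (ar : F → ℕ) (V : Set) →
    let open Rewriting F ar V in
    (R : TRS) (Π : ForbiddenPattern → Set)
    (C : Term) (p : Pos) (s t Cs Ct : Term) →
    Replace C p s Cs → Replace C p t Ct →
    StepBelow R Π p Cs Ct →
    Step R Π s t
lemma3 F ar V R Π C p s t Cs Ct plug-s plug-t (_ , (q , refl) , step)
  with Plugging.StepAt-below-hole F ar V R Π plug-s step
... | s' , stepInside , plug-s'
  with Plugging.plug-injective F ar V plug-s' plug-t refl
... | refl = q , stepInside
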